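{- Let $G$ be a graph, $(u,v)\in V_p$ and $w\in V(G)$. Then $r_w(u,v)=\frac12$ if and only if $w\in\{u,v\}$ and $V_i(u)\setminus\{v\}=V_i(v)\setminus\{u\}$ for every $1\leq i\leq\mathrm{diam}(G)$.
   Context: All graphs are finite, simple, connected and have at least two vertices; $d(x,y)$ is the shortest-path distance and $\mathrm{diam}(G)$ the maximum distance. For $w\in V(G)$, $V_i(w)=\{v\in V(G)\setminus\{w\}: d(v,w)=i\}$. A vertex $w$ resolves $u,v$ if $d(u,w)\neq d(v,w)$. $V_p$ is the set of all unordered pairs of distinct vertices. For $(u,v)\in V_p$, $R(u,v)=\{x: x\text{ resolves } u,v\}$, and $r_w(u,v)=1/|R(u,v)|$ if $w$ resolves $u,v$, else $0$. -}

module Defs where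

open import Data.Bool using (Bool; true; false; _∧_; _∨_; if_then_else_; not)
open import Data.Nat using (ℕ; zero; suc; _≤_; _⊔_; _≡ᵇ_)
open import Data.Fin using (Fin; _≟_)
open import Data.Bool.ListAction using (any)
open import Data.List using (List; map; foldr; filterᵇ; length)
open import Data.List.Base using (allFin)
open import Data.Integer using (+_)
open import Data.Rational using (ℚ; _/_; 0ℚ)
open import Data.Product using (∃; _×_)
open import Relation.Binary.PropositionalEquality using (_≡_; _≢_)
open import Relation.Nullary.Decidable using (⌊_⌋)

reachWith : {n : ℕ} → (Fin n → Fin n → Bool) → ℕ → Fin n → Fin n → Bool
reachWith adj zero    x y = ⌊ x ≟ y ⌋
reachWith {n} adj (suc k) x y =
  reachWith adj k x y ∨ any (λ z → adj x z ∧ reachWith adj k z y) (allFin n)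

record Graph : Set where
  field
    n         : ℕ
    two≤n     : 2 ≤ n
    adj       : Fin n → Fin n → Bool
    adj-sym   : ∀ x y → adj x y ≡ adj y x
    adj-irr   : ∀ x → adj x x ≡ false
    connected : ∀ x y → ∃ λ k → reachWith adj k x y ≡ true

  reach : ℕ → Fin n → Fin n → Bool
  reach = reachWith adj

module _ (G : Graph) where
  open Graph G

  distAux : ℕ → ℕ → Fin n → Fin n → ℕ
  distAux k zero    x y = k
  distAux k (suc f) x y = if reach k x y then k else distAux (suc k) f x y

  dist : Fin n → Fin n → ℕ
  dist x y = distAux 0 n x y

  diam : ℕ
  diam = foldr _⊔_ 0 (map (λ x → foldr _⊔_ 0 (map (dist x) (allFin n))) (allFin n))

  InV : ℕ → Fin n → Fin n → Set
  InV i w x = (x ≢ w) × (dist x w ≡ i)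

  Resolves : Fin n → Fin n → Fin n → Set
  Resolves w u v = dist u w ≢ dist v w

  cardR : Fin n → Fin n → ℕ
  cardR u v = length (filterᵇ (λ x → not (dist u x ≡ᵇ dist v x)) (allFin n))

  inv : ℕ → ℚ
  inv zero    = 0ℚ
  inv (suc k) = + 1 / suc k

  r : Fin n → Fin n → Fin n → ℚ
  r w u v = if dist u w ≡ᵇ dist v w then 0ℚ else inv (cardR u v)

module Submission where

-- Since r_w(u,v) is 0 or 1/|R(u,v)|, the value ½ occurs exactly when w resolves
-- u,v and |R(u,v)| = 2.  Both u and v always resolve u,v (d(u,u) = 0 < d(v,u)),
-- so |R(u,v)| = 2 means R(u,v) = {u,v}: no third vertex resolves u,v.  That is
-- the statement that u and v are twins, d(x,u) = d(x,v) for every x ∉ {u,v},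
-- which in turn is a rephrasing of the equality of their layers V_i.

open import Defs
import Data.Nat as ℕ
open import Data.Nat using (ℕ; zero; suc; _≤_; _⊔_; _≡ᵇ_; z≤n; s≤s)
open import Data.Nat.Properties using (≤-refl; ≤-trans; ≤-antisym; m≤m⊔n; m≤n⊔m; n≤1+n; ≡ᵇ⇒≡; ≡⇒≡ᵇ)
open import Data.Fin using (Fin; _≟_)
open import Data.Bool using (Bool; true; false; T; not; T?)
open import Data.Bool.Properties using (T-∨; T-∧)
open import Data.List using (List; []; _∷_; length; filter; filterᵇ; map; foldr; allFin)
open import Data.List.Properties using (filter-notAll)
open import Data.List.Membership.Propositional using (_∈_; lose)
open import Data.List.Membership.Propositional.Properties using (∈-allFin; ∈-filter⁺; ∈-filter⁻; ∈-map⁺)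
open import Data.List.Relation.Binary.Subset.Propositional using (_⊆_)
open import Data.List.Relation.Unary.Any using (here; there; satisfied)
import Data.List.Relation.Unary.Any as Any
open import Data.List.Relation.Unary.Any.Properties using (any⁺; any⁻)
open import Data.List.Relation.Unary.All using ([]; _∷_) renaming (lookup to All-lookup)
open import Data.List.Relation.Unary.AllPairs using ([]; _∷_)
open import Data.List.Relation.Unary.Unique.Propositional using (Unique)
open import Data.List.Relation.Unary.Unique.Propositional.Properties using (allFin⁺; filter⁺)
open import Data.Rational using (½; ↧_)
open import Data.Rational.Properties using (↧-/)
open import Data.Integer using (+_; _*_)
open import Data.Integer.Properties using (+-injective)
open import Data.Integer.GCD using (gcd; gcd-zeroˡ)
open import Data.Product using (_×_; _,_; proj₁; proj₂; ∃-syntax)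
open import Data.Sum using (_⊎_; inj₁; inj₂; [_,_]′)
open import Data.Empty using (⊥-elim)
open import Function.Bundles using (_⇔_; mk⇔; Equivalence)
open import Relation.Binary.PropositionalEquality using (_≡_; _≢_; refl; sym; trans; cong; cong₂; subst; module ≡-Reasoning)
open import Relation.Binary.Definitions using (DecidableEquality)
open import Relation.Nullary using (yes; no; ¬?)
open import Relation.Nullary.Decidable using (toWitness; fromWitness)

open Equivalence using (to; from)

T-ext : ∀ {a b} → (T a → T b) → (T b → T a) → a ≡ b
T-ext {true}  {true}  _ _ = refl
T-ext {true}  {false} f _ = ⊥-elim (f _)
T-ext {false} {true}  _ g = ⊥-elim (g _)
T-ext {false} {false} _ _ = refl

∈⇒≤max : ∀ {a} xs → a ∈ xs → a ≤ foldr _⊔_ 0 xs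
∈⇒≤max (x ∷ xs) (here refl) = m≤m⊔n x _
∈⇒≤max (x ∷ xs) (there a∈xs) = ≤-trans (∈⇒≤max xs a∈xs) (m≤n⊔m x _)

-- Pigeonhole: a duplicate-free list contained in another list is no longer.
-- Removing the head x of xs from ys strictly shortens ys (x ∈ ys), and the
-- tail of xs still fits into what remains.
module _ {A : Set} (_≟ᴬ_ : DecidableEquality A) where

  unique-⊆⇒length≤ : ∀ {xs ys : List A} → Unique xs → xs ⊆ ys → length xs ≤ length ys
  unique-⊆⇒length≤ {[]}     _                 _        = z≤n
  unique-⊆⇒length≤ {x ∷ xs} {ys} (x∉xs ∷ xs!) x∷xs⊆ys =
    ≤-trans (s≤s (unique-⊆⇒length≤ xs! xs⊆ys∖x)) (filter-notAll (λ y → ¬? (y ≟ᴬ x)) ys x∈ys)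
    where
    x∈ys = Any.map (λ x≡y y≢x → y≢x (sym x≡y)) (x∷xs⊆ys (here refl))
    xs⊆ys∖x : xs ⊆ filter (λ y → ¬? (y ≟ᴬ x)) ys
    xs⊆ys∖x y∈xs = ∈-filter⁺ (λ y → ¬? (y ≟ᴬ x)) (x∷xs⊆ys (there y∈xs))
                     (λ y≡x → All-lookup x∉xs y∈xs (sym y≡x))

-- The value ½ of 1/c forces c = 2 (compare the reduced denominators).
inv≡½⇒≡2 : ∀ G c → inv G c ≡ ½ → c ≡ 2
inv≡½⇒≡2 G (suc c) 1/c≡½ = +-injective (begin
  + suc c                                 ≡⟨ sym (↧-/ (+ 1) (suc c)) ⟩
  ↧ inv G (suc c) * gcd (+ 1) (+ suc c)   ≡⟨ cong₂ (λ q g → ↧ q * g) 1/c≡½ (gcd-zeroˡ (+ suc c)) ⟩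
  + 2                                     ∎)
  where open ≡-Reasoning

module Distance (G : Graph) where
  open Graph G

  reach-zero : ∀ {x y} → T (reach 0 x y) ⇔ (x ≡ y)
  reach-zero = mk⇔ toWitness fromWitness

  reach-suc : ∀ k {x y} →
    T (reach (suc k) x y) ⇔ (T (reach k x y) ⊎ ∃[ z ] (T (adj x z) × T (reach k z y)))
  reach-suc k {x} {y} = mk⇔ unfold fold
    where
    unfold : T (reach (suc k) x y) → T (reach k x y) ⊎ ∃[ z ] (T (adj x z) × T (reach k z y))
    unfold r with to T-∨ r
    ... | inj₁ shorter = inj₁ shorter
    ... | inj₂ step with satisfied (any⁻ _ (allFin n) step)
    ...   | z , edge+walk = inj₂ (z , to T-∧ edge+walk)
    fold : T (reach k x y) ⊎ ∃[ z ] (T (adj x z) × T (reach k z y)) → T (reach (suc k) x y)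
    fold (inj₁ shorter)         = from T-∨ (inj₁ shorter)
    fold (inj₂ (z , edge+walk)) = from T-∨ (inj₂ (any⁺ _ (lose (∈-allFin z) (from T-∧ edge+walk))))

  reach-snoc : ∀ k {x z y} → T (reach k x z) → T (adj z y) → T (reach (suc k) x y)
  reach-snoc zero {y = y} x≡z z~y with refl ← to reach-zero x≡z =
    from (reach-suc 0) (inj₂ (y , z~y , from reach-zero refl))
  reach-snoc (suc k) walk z~y with to (reach-suc k) walk
  ... | inj₁ shorter             = from (reach-suc (suc k)) (inj₁ (reach-snoc k shorter z~y))
  ... | inj₂ (x′ , x~x′ , rest) = from (reach-suc (suc k)) (inj₂ (x′ , x~x′ , reach-snoc k rest z~y))

  reach-reverse : ∀ k {x y} → T (reach k x y) → T (reach k y x)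
  reach-reverse zero    x≡y = from reach-zero (sym (to reach-zero x≡y))
  reach-reverse (suc k) {x} {y} walk with to (reach-suc k) walk
  ... | inj₁ shorter           = from (reach-suc k) (inj₁ (reach-reverse k shorter))
  ... | inj₂ (z , x~z , z⇝y)  = reach-snoc k (reach-reverse k z⇝y) (subst T (adj-sym x z) x~z)

  reach-sym : ∀ k x y → reach k x y ≡ reach k y x
  reach-sym k x y = T-ext (reach-reverse k) (reach-reverse k)

  distAux-sym : ∀ k f x y → distAux G k f x y ≡ distAux G k f y x
  distAux-sym k zero    x y = refl
  distAux-sym k (suc f) x y rewrite reach-sym k x y with reach k y x
  ... | true  = refl
  ... | false = distAux-sym (suc k) f x y

  dist-sym : ∀ x y → dist G x y ≡ dist G y x
  dist-sym = distAux-sym 0 n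

  distAux-hit : ∀ k f {x y} → T (reach k x y) → distAux G k f x y ≡ k
  distAux-hit k zero    _ = refl
  distAux-hit k (suc f) {x} {y} walk with reach k x y
  ... | true = refl

  dist-refl : ∀ x → dist G x x ≡ 0
  dist-refl x = distAux-hit 0 n (from reach-zero refl)

  distAux-≥ : ∀ k f x y → k ≤ distAux G k f x y
  distAux-≥ k zero    x y = ≤-refl
  distAux-≥ k (suc f) x y with reach k x y
  ... | true  = ≤-refl
  ... | false = ≤-trans (n≤1+n k) (distAux-≥ (suc k) f x y)

  dist-pos : ∀ x y → x ≢ y → 1 ≤ dist G x y
  dist-pos x y x≢y = search-pos n (≤-trans (s≤s z≤n) two≤n)
    where
    search-pos : ∀ f → 1 ≤ f → 1 ≤ distAux G 0 f x y
    search-pos (suc f) _ with x ≟ y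
    ... | yes x≡y = ⊥-elim (x≢y x≡y)
    ... | no  _   = distAux-≥ 1 f x y

  dist≢0 : ∀ x y → x ≢ y → dist G x y ≢ 0
  dist≢0 x y x≢y d≡0 with subst (1 ≤_) d≡0 (dist-pos x y x≢y)
  ... | ()

  dist≤diam : ∀ x y → dist G x y ≤ diam G
  dist≤diam x y = ≤-trans (∈⇒≤max _ (∈-map⁺ (dist G x) (∈-allFin y)))
                          (∈⇒≤max _ (∈-map⁺ eccentricity (∈-allFin x)))
    where
    eccentricity : Fin n → ℕ
    eccentricity x = foldr _⊔_ 0 (map (dist G x) (allFin n))

module Pair (G : Graph) (u v : Fin (Graph.n G)) (u≢v : u ≢ v) where
  open Graph G
  open Distance G

  resolves? : Fin n → Bool
  resolves? x = not (dist G u x ≡ᵇ dist G v x)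

  T-resolves? : ∀ x → T (resolves? x) ⇔ Resolves G x u v
  T-resolves? x with dist G u x ≡ᵇ dist G v x in test
  ... | true  = mk⇔ (λ ()) (λ x-res → x-res (≡ᵇ⇒≡ _ _ (subst T (sym test) _)))
  ... | false = mk⇔ (λ _ d≡ → subst T test (≡⇒≡ᵇ _ _ d≡)) (λ _ → _)

  resolvingList : List (Fin n)
  resolvingList = filterᵇ resolves? (allFin n)

  resolvingList-unique : Unique resolvingList
  resolvingList-unique = filter⁺ (λ y → T? (resolves? y)) (allFin⁺ n)

  ∈-resolvingList : ∀ {x} → Resolves G x u v → x ∈ resolvingList
  ∈-resolvingList {x} x-res =
    ∈-filter⁺ (λ y → T? (resolves? y)) (∈-allFin x) (from (T-resolves? x) x-res)

  resolvingList-resolves : ∀ {x} → x ∈ resolvingList → Resolves G x u v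
  resolvingList-resolves {x} x∈ =
    to (T-resolves? x) (proj₂ (∈-filter⁻ (λ y → T? (resolves? y)) {xs = allFin n} x∈))

  -- Each endpoint resolves the pair: d(u,u) = 0 ≠ d(v,u), d(u,v) ≠ 0 = d(v,v).
  u-resolves : Resolves G u u v
  u-resolves d≡ = dist≢0 v u (λ v≡u → u≢v (sym v≡u)) (trans (sym d≡) (dist-refl u))

  v-resolves : Resolves G v u v
  v-resolves d≡ = dist≢0 u v u≢v (trans d≡ (dist-refl v))

  endpoint-resolves : ∀ {w} → w ≡ u ⊎ w ≡ v → Resolves G w u v
  endpoint-resolves (inj₁ refl) = u-resolves
  endpoint-resolves (inj₂ refl) = v-resolves

  OnlyEndpointsResolve : Set
  OnlyEndpointsResolve = ∀ x → Resolves G x u v → x ≡ u ⊎ x ≡ v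

  -- Since u, v ∈ R(u,v) always, |R(u,v)| = 2 exactly when R(u,v) ⊆ {u,v};
  -- a third resolving vertex would give three distinct members (pigeonhole).
  cardR≡2⇔ : cardR G u v ≡ 2 ⇔ OnlyEndpointsResolve
  cardR≡2⇔ = mk⇔ only-endpoints exactly-two
    where
    only-endpoints : cardR G u v ≡ 2 → OnlyEndpointsResolve
    only-endpoints |R|≡2 x x-res with x ≟ u | x ≟ v
    ... | yes x≡u | _       = inj₁ x≡u
    ... | no _    | yes x≡v = inj₂ x≡v
    ... | no x≢u  | no x≢v  with subst (3 ≤_) |R|≡2 (unique-⊆⇒length≤ _≟_ uvx-unique uvx⊆R)
      where
      uvx-unique : Unique (u ∷ v ∷ x ∷ [])
      uvx-unique = (u≢v ∷ (λ u≡x → x≢u (sym u≡x)) ∷ [])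
                 ∷ ((λ v≡x → x≢v (sym v≡x)) ∷ []) ∷ [] ∷ []
      uvx⊆R : u ∷ v ∷ x ∷ [] ⊆ resolvingList
      uvx⊆R (here refl)                 = ∈-resolvingList u-resolves
      uvx⊆R (there (here refl))         = ∈-resolvingList v-resolves
      uvx⊆R (there (there (here refl))) = ∈-resolvingList x-res
    ... | s≤s (s≤s ())

    exactly-two : OnlyEndpointsResolve → cardR G u v ≡ 2
    exactly-two only = ≤-antisym
      (unique-⊆⇒length≤ _≟_ resolvingList-unique R⊆uv)
      (unique-⊆⇒length≤ _≟_ ((u≢v ∷ []) ∷ [] ∷ []) uv⊆R)
      where
      R⊆uv : resolvingList ⊆ u ∷ v ∷ []
      R⊆uv x∈R with only _ (resolvingList-resolves x∈R)
      ... | inj₁ refl = here refl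
      ... | inj₂ refl = there (here refl)
      uv⊆R : u ∷ v ∷ [] ⊆ resolvingList
      uv⊆R (here refl)         = ∈-resolvingList u-resolves
      uv⊆R (there (here refl)) = ∈-resolvingList v-resolves

  Twins : Set
  Twins = ∀ x → x ≢ u → x ≢ v → dist G x u ≡ dist G x v

  onlyEndpoints⇔twins : OnlyEndpointsResolve ⇔ Twins
  onlyEndpoints⇔twins = mk⇔ twins only-endpoints
    where
    twins : OnlyEndpointsResolve → Twins
    twins only x x≢u x≢v with dist G u x ℕ.≟ dist G v x
    ... | yes d≡ = trans (dist-sym x u) (trans d≡ (dist-sym v x))
    ... | no x-res = ⊥-elim ([ x≢u , x≢v ]′ (only x x-res))

    only-endpoints : Twins → OnlyEndpointsResolve
    only-endpoints twin x x-res with x ≟ u | x ≟ v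
    ... | yes x≡u | _       = inj₁ x≡u
    ... | no _    | yes x≡v = inj₂ x≡v
    ... | no x≢u  | no x≢v  =
      ⊥-elim (x-res (trans (dist-sym u x) (trans (twin x x≢u x≢v) (dist-sym x v))))

  SameLayers : Set
  SameLayers = ∀ (i : ℕ) → 1 ≤ i → i ≤ diam G → ∀ x →
    (InV G i u x × x ≢ v) ⇔ (InV G i v x × x ≢ u)

  -- Twins have the same layers; conversely a vertex x ∉ {u,v} lies in the layer
  -- i = d(x,u) of u, which is in range, hence also in the layer i of v.
  twins⇔sameLayers : Twins ⇔ SameLayers
  twins⇔sameLayers = mk⇔ same-layers twins
    where
    same-layers : Twins → SameLayers
    same-layers twin i _ _ x = mk⇔
      (λ { ((x≢u , d≡i) , x≢v) → (x≢v , trans (sym (twin x x≢u x≢v)) d≡i) , x≢u })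
      (λ { ((x≢v , d≡i) , x≢u) → (x≢u , trans (twin x x≢u x≢v) d≡i) , x≢v })

    twins : SameLayers → Twins
    twins layers x x≢u x≢v = sym (proj₂ (proj₁ (to
      (layers (dist G x u) (dist-pos x u x≢u) (dist≤diam x u) x) ((x≢u , refl) , x≢v))))

  -- r_w(u,v) is 0 or 1/|R(u,v)|, so it equals ½ iff w resolves and |R(u,v)| = 2.
  r≡½⇔ : ∀ w → r G w u v ≡ ½ ⇔ (Resolves G w u v × cardR G u v ≡ 2)
  r≡½⇔ w with dist G u w ≡ᵇ dist G v w in test
  ... | true  = mk⇔ (λ ()) (λ (w-res , _) → ⊥-elim (w-res (≡ᵇ⇒≡ _ _ (subst T (sym test) _))))
  ... | false = mk⇔
    (λ half → (λ d≡ → subst T test (≡⇒≡ᵇ _ _ d≡)) , inv≡½⇒≡2 G _ half)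
    (λ (_ , |R|≡2) → cong (inv G) |R|≡2)

lemma2p5 : (G : Graph) (u v w : Fin (Graph.n G)) → u ≢ v →
    (r G w u v ≡ ½) ⇔
      ((w ≡ u ⊎ w ≡ v) ×
       (∀ (i : ℕ) → 1 ≤ i → i ≤ diam G → ∀ x →
          (InV G i u x × x ≢ v) ⇔ (InV G i v x × x ≢ u)))
lemma2p5 G u v w u≢v = mk⇔ necessary sufficient
  where
  open Pair G u v u≢v

  necessary : r G w u v ≡ ½ → (w ≡ u ⊎ w ≡ v) × SameLayers
  necessary half =
    let (w-res , |R|≡2) = to (r≡½⇔ w) half
        only            = to cardR≡2⇔ |R|≡2
    in only w w-res , to twins⇔sameLayers (to onlyEndpoints⇔twins only)

  sufficient : (w ≡ u ⊎ w ≡ v) × SameLayers → r G w u v ≡ ½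
  sufficient (w∈uv , layers) = from (r≡½⇔ w)
    (endpoint-resolves w∈uv , from cardR≡2⇔ (from onlyEndpoints⇔twins (from twins⇔sameLayers layers)))
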